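{- Let $X$ be a set with a ternary relation $R$ and $(Q,\le,\bullet)$ a prequantale with least element $0$; let $\ast$ be the convolution on $Q^X$. (1) If $R$ is relationally associative and $\bullet$ is associative, then $\ast$ is associative. (2) If $\ast$ is associative and there exist $a,b,c\in Q$ with $a\bullet(b\bullet c)\neq0\neq(a\bullet b)\bullet c$, then $R$ is relationally associative. (3) If $\ast$ is associative and there exist $x,y,z,u,v,w\in X$ with $R^x_{uz}$, $R^x_{yw}$, $R^z_{vw}$ and $R^y_{uv}$, then $\bullet$ is associative.
   Context: $R^x_{yz}$ means $R$ holds at $(x,y,z)$. Relational associativity: for all $x,u,v,w$, $(\exists y.\ R^y_{uv}\wedge R^x_{yw})\Leftrightarrow(\exists y.\ R^x_{uy}\wedge R^y_{vw})$. A prequantale is a complete lattice with a binary operation preserving arbitrary sups in both arguments. Convolution: $(f\ast g)(x)=\bigvee\{f(y)\bullet g(z)\mid R^x_{yz}\}$ for $f,g:X\to Q$. -}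

module Defs where

open import Level using (Level; _⊔_; suc)
open import Data.Product using (Σ; Σ-syntax; _×_; _,_; ∃-syntax)
open import Data.Empty.Polymorphic using (⊥; ⊥-elim)
open import Relation.Binary.PropositionalEquality using (_≡_)
open import Relation.Binary.Structures using (IsPartialOrder)
open import Function.Bundles using (_⇔_)

record Prequantale (c ℓ ι : Level) : Set (suc (c ⊔ ℓ ⊔ ι)) where
  infixl 7 _•_
  infix 4 _≤_
  field
    Carrier        : Set c
    _≤_            : Carrier → Carrier → Set ℓ
    isPartialOrder : IsPartialOrder _≡_ _≤_
    ⋁              : {I : Set ι} → (I → Carrier) → Carrier
    ⋁-upper        : {I : Set ι} (f : I → Carrier) (i : I) → f i ≤ ⋁ f
    ⋁-least        : {I : Set ι} (f : I → Carrier) (q : Carrier) →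
                     ((i : I) → f i ≤ q) → ⋁ f ≤ q
    _•_            : Carrier → Carrier → Carrier
    •-⋁ˡ           : {I : Set ι} (f : I → Carrier) (a : Carrier) →
                     ⋁ f • a ≡ ⋁ (λ i → f i • a)
    •-⋁ʳ           : {I : Set ι} (a : Carrier) (f : I → Carrier) →
                     a • ⋁ f ≡ ⋁ (λ i → a • f i)

  𝟘 : Carrier
  𝟘 = ⋁ {I = ⊥} ⊥-elim

module _ {c ℓ ι : Level} {X : Set ι} (R : X → X → X → Set ι)
         (Q : Prequantale c ℓ ι) where
  open Prequantale Q

  -- R x y z  stands for  R^x_{yz}.
  -- Convolution: (f ∗ g)(x) = ⋁ { f y • g z | R^x_{yz} }
  conv : (X → Carrier) → (X → Carrier) → X → Carrier
  conv f g x = ⋁ {I = Σ[ p ∈ X × X ] R x (Σ.proj₁ p) (Σ.proj₂ p)}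
                 (λ { ((y , z) , _) → f y • g z })

  ConvAssociative : Set (c ⊔ ι)
  ConvAssociative = (f g h : X → Carrier) (x : X) →
                    conv f (conv g h) x ≡ conv (conv f g) h x

  •-Associative : Set c
  •-Associative = (a b c : Carrier) → a • (b • c) ≡ (a • b) • c

RelAssociative : {ι : Level} {X : Set ι} → (X → X → X → Set ι) → Set ι
RelAssociative {X = X} R = (x u v w : X) →
  (∃[ y ] (R y u v × R x y w)) ⇔ (∃[ y ] (R x u y × R y v w))

module Submission where

-- Writing (f ∗ (g ∗ h))(x) out, distributivity of • over sups
-- shows it is the least upper bound of all  f u • (g v • h w)  with x a
-- "left splitting" u(vw), i.e. R^x_{uz} and R^z_{vw} for some z; dually
-- ((f ∗ g) ∗ h)(x) is the least upper bound of  (f u • g v) • h w  over the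
-- "right splittings" (uv)w.  All three parts follow from this description.
--  (1) Relational associativity matches left and right splittings, and
--      associativity of • matches the corresponding terms, so both sups agree.
--  (3) For constant functions a, b, d both sups are a single value,
--      a • (b • d) resp. (a • b) • d, as soon as some x has both splittings.
--  (2) For "points" (a at u, 0 elsewhere, and likewise b at v, d at w) the
--      left sup at x is at least a • (b • d) if x splits as u(vw) and is 0
--      otherwise, and dually on the right; so by excluded middle a nonzero
--      product forces the splittings to exist together.

open import Defs
open import Level using (Level; Lift; lift)
open import Data.Bool using (Bool; true; false)
open import Data.Empty using () renaming (⊥-elim to ⊥-elim₀)
open import Data.Product using (_×_; ∃-syntax; _,_)
open import Function.Base using (const)
open import Function.Bundles using (mk⇔; Equivalence)
open import Relation.Binary.Bundles using (Poset)
open import Relation.Binary.PropositionalEquality using (_≡_; refl; cong; sym; module ≡-Reasoning)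
open import Relation.Binary.Structures using (IsPartialOrder)
open import Relation.Nullary using (¬_; yes; no)
open import Axiom.ExcludedMiddle using (ExcludedMiddle)
import Relation.Binary.Reasoning.PartialOrder as PosetReasoning

module PrequantaleProperties {c ℓ ι : Level} (Q : Prequantale c ℓ ι) where
  open Prequantale Q
  open IsPartialOrder isPartialOrder public
    using (antisym; trans; reflexive) renaming (refl to ≤-refl)

  poset : Poset c c ℓ
  poset = record { isPartialOrder = isPartialOrder }

  module ≤-Reasoning = PosetReasoning poset

  𝟘-least : (q : Carrier) → 𝟘 ≤ q
  𝟘-least q = ⋁-least _ q (λ ())

  ≤𝟘⇒≡𝟘 : {q : Carrier} → q ≤ 𝟘 → q ≡ 𝟘
  ≤𝟘⇒≡𝟘 q≤𝟘 = antisym q≤𝟘 (𝟘-least _)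

  pair : Carrier → Carrier → Lift ι Bool → Carrier
  pair a b (lift true)  = a
  pair a b (lift false) = b

  ⋁-pair : {a b : Carrier} → a ≤ b → ⋁ (pair a b) ≡ b
  ⋁-pair {a} {b} a≤b =
    antisym (⋁-least _ b λ { (lift true) → a≤b ; (lift false) → ≤-refl })
            (⋁-upper (pair a b) (lift false))

  -- • is monotone in each argument, since it preserves the sup of {a, b}.
  •-monoˡ : {a b : Carrier} (q : Carrier) → a ≤ b → a • q ≤ b • q
  •-monoˡ {a} {b} q a≤b = begin
    a • q                        ≤⟨ ⋁-upper (λ i → pair a b i • q) (lift true) ⟩
    ⋁ (λ i → pair a b i • q)     ≡⟨ sym (•-⋁ˡ (pair a b) q) ⟩
    ⋁ (pair a b) • q             ≡⟨ cong (_• q) (⋁-pair a≤b) ⟩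
    b • q                        ∎
    where open ≤-Reasoning

  •-monoʳ : {a b : Carrier} (q : Carrier) → a ≤ b → q • a ≤ q • b
  •-monoʳ {a} {b} q a≤b = begin
    q • a                        ≤⟨ ⋁-upper (λ i → q • pair a b i) (lift true) ⟩
    ⋁ (λ i → q • pair a b i)     ≡⟨ sym (•-⋁ʳ q (pair a b)) ⟩
    q • ⋁ (pair a b)             ≡⟨ cong (q •_) (⋁-pair a≤b) ⟩
    q • b                        ∎
    where open ≤-Reasoning

  ⋁•-least : {I : Set ι} (f : I → Carrier) (a q : Carrier) →
             ((i : I) → f i • a ≤ q) → ⋁ f • a ≤ q
  ⋁•-least f a q h = trans (reflexive (•-⋁ˡ f a)) (⋁-least _ q h)

  •⋁-least : {I : Set ι} (a : Carrier) (f : I → Carrier) (q : Carrier) →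
             ((i : I) → a • f i ≤ q) → a • ⋁ f ≤ q
  •⋁-least a f q h = trans (reflexive (•-⋁ʳ a f)) (⋁-least _ q h)

module ConvolutionProperties {c ℓ ι : Level} {X : Set ι}
         (R : X → X → X → Set ι) (Q : Prequantale c ℓ ι) where
  open Prequantale Q
  open PrequantaleProperties Q

  infixl 7 _∗_
  _∗_ : (X → Carrier) → (X → Carrier) → X → Carrier
  _∗_ = conv R Q

  -- x splits as u(vw), resp. as (uv)w.  Relational associativity says
  -- exactly that  RightSplit x u v w ⇔ LeftSplit x u v w.
  LeftSplit RightSplit : X → X → X → X → Set ι
  LeftSplit  x u v w = ∃[ z ] (R x u z × R z v w)
  RightSplit x u v w = ∃[ y ] (R y u v × R x y w)

  ∗-upper : (f g : X → Carrier) {x y z : X} → R x y z → f y • g z ≤ (f ∗ g) x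
  ∗-upper f g r = ⋁-upper _ ((_ , _) , r)

  ∗-least : (f g : X → Carrier) (x : X) (q : Carrier) →
            (∀ {y z} → R x y z → f y • g z ≤ q) → (f ∗ g) x ≤ q
  ∗-least f g x q h = ⋁-least _ q (λ { ((y , z) , r) → h r })

  ∗-assocˡ-upper : (f g h : X → Carrier) {x u v w z : X} →
                   R x u z → R z v w → f u • (g v • h w) ≤ (f ∗ (g ∗ h)) x
  ∗-assocˡ-upper f g h rxuz rzvw =
    trans (•-monoʳ (f _) (∗-upper g h rzvw)) (∗-upper f (g ∗ h) rxuz)

  ∗-assocˡ-least : (f g h : X → Carrier) (x : X) (q : Carrier) →
                   (∀ {u v w z} → R x u z → R z v w → f u • (g v • h w) ≤ q) →
                   (f ∗ (g ∗ h)) x ≤ q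
  ∗-assocˡ-least f g h x q bound = ∗-least f (g ∗ h) x q λ rxuz →
    •⋁-least _ _ q λ { ((v , w) , rzvw) → bound rxuz rzvw }

  ∗-assocʳ-upper : (f g h : X → Carrier) {x u v w y : X} →
                   R y u v → R x y w → (f u • g v) • h w ≤ ((f ∗ g) ∗ h) x
  ∗-assocʳ-upper f g h ryuv rxyw =
    trans (•-monoˡ (h _) (∗-upper f g ryuv)) (∗-upper (f ∗ g) h rxyw)

  ∗-assocʳ-least : (f g h : X → Carrier) (x : X) (q : Carrier) →
                   (∀ {u v w y} → R y u v → R x y w → (f u • g v) • h w ≤ q) →
                   ((f ∗ g) ∗ h) x ≤ q
  ∗-assocʳ-least f g h x q bound = ∗-least (f ∗ g) h x q λ rxyw →
    ⋁•-least _ _ q λ { ((u , v) , ryuv) → bound ryuv rxyw }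

  ∗-assoc-from-rel : RelAssociative R → •-Associative R Q → ConvAssociative R Q
  ∗-assoc-from-rel rel-assoc •-assoc f g h x = antisym left≤right right≤left
    where
      left≤right : (f ∗ (g ∗ h)) x ≤ ((f ∗ g) ∗ h) x
      left≤right = ∗-assocˡ-least f g h x _ λ rxuz rzvw →
        let (y , ryuv , rxyw) = Equivalence.from (rel-assoc x _ _ _) (_ , rxuz , rzvw)
        in trans (reflexive (•-assoc _ _ _)) (∗-assocʳ-upper f g h ryuv rxyw)

      right≤left : ((f ∗ g) ∗ h) x ≤ (f ∗ (g ∗ h)) x
      right≤left = ∗-assocʳ-least f g h x _ λ ryuv rxyw →
        let (z , rxuz , rzvw) = Equivalence.to (rel-assoc x _ _ _) (_ , ryuv , rxyw)
        in trans (reflexive (sym (•-assoc _ _ _))) (∗-assocˡ-upper f g h rxuz rzvw)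

  -- For constant functions every term of the triple sups is the same, so at
  -- a point with a splitting the sup is that single value.
  const-∗-assocˡ : (a b d : Carrier) {x u v w z : X} → R x u z → R z v w →
                   (const a ∗ (const b ∗ const d)) x ≡ a • (b • d)
  const-∗-assocˡ a b d rxuz rzvw =
    antisym (∗-assocˡ-least _ _ _ _ _ λ _ _ → ≤-refl)
            (∗-assocˡ-upper _ _ _ rxuz rzvw)

  const-∗-assocʳ : (a b d : Carrier) {x u v w y : X} → R y u v → R x y w →
                   ((const a ∗ const b) ∗ const d) x ≡ (a • b) • d
  const-∗-assocʳ a b d ryuv rxyw =
    antisym (∗-assocʳ-least _ _ _ _ _ λ _ _ → ≤-refl)
            (∗-assocʳ-upper _ _ _ ryuv rxyw)

  •-assoc-from-∗ : ConvAssociative R Q →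
                   (∃[ x ] ∃[ y ] ∃[ z ] ∃[ u ] ∃[ v ] ∃[ w ]
                     (R x u z × R x y w × R z v w × R y u v)) →
                   •-Associative R Q
  •-assoc-from-∗ ∗-assoc (x , y , z , u , v , w , rxuz , rxyw , rzvw , ryuv) a b d =
    begin
      a • (b • d)                         ≡⟨ sym (const-∗-assocˡ a b d rxuz rzvw) ⟩
      (const a ∗ (const b ∗ const d)) x   ≡⟨ ∗-assoc _ _ _ x ⟩
      ((const a ∗ const b) ∗ const d) x   ≡⟨ const-∗-assocʳ a b d ryuv rxyw ⟩
      (a • b) • d                         ∎
    where open ≡-Reasoning

  -- The point with value a at u: constructively, the sup of a over the
  -- proofs of t ≡ u, so it is a at u and 𝟘 wherever t ≡ u is refutable.
  point : X → Carrier → X → Carrier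
  point u a t = ⋁ {I = t ≡ u} (λ _ → a)

  point-upper : (u : X) (a : Carrier) → a ≤ point u a u
  point-upper u a = ⋁-upper _ refl

  point-least : {u t : X} {a q : Carrier} → (t ≡ u → a ≤ q) → point u a t ≤ q
  point-least h = ⋁-least _ _ h

  point-•ˡ : (u : X) (a q : Carrier) (t : X) → point u a t • q ≡ point u (a • q) t
  point-•ˡ u a q t = •-⋁ˡ _ q

  point-•ʳ : (u : X) (a q : Carrier) (t : X) → q • point u a t ≡ point u (q • a) t
  point-•ʳ u a q t = •-⋁ʳ q _

  point³ : X → X → X → Carrier → X → X → X → Carrier
  point³ u v w e u' v' w' = point u (point v (point w e w') v') u'

  point³-upper : (u v w : X) (e : Carrier) → e ≤ point³ u v w e u v w
  point³-upper u v w e =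
    trans (point-upper w e) (trans (point-upper v _) (point-upper u _))

  point³-least : {u v w u' v' w' : X} {e q : Carrier} →
                 (u' ≡ u → v' ≡ v → w' ≡ w → e ≤ q) → point³ u v w e u' v' w' ≤ q
  point³-least h =
    point-least λ u'≡u → point-least λ v'≡v → point-least λ w'≡w → h u'≡u v'≡v w'≡w

  point-assocˡ : (u v w : X) (a b d : Carrier) (u' v' w' : X) →
                 point u a u' • (point v b v' • point w d w')
                   ≡ point³ u v w (a • (b • d)) u' v' w'
  point-assocˡ u v w a b d u' v' w' = begin
    point u a u' • (point v b v' • point w d w')
      ≡⟨ cong (point u a u' •_) (point-•ˡ v b _ v') ⟩
    point u a u' • point v (b • point w d w') v'
      ≡⟨ cong (λ e → point u a u' • point v e v') (point-•ʳ w d b w') ⟩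
    point u a u' • point v (point w (b • d) w') v'
      ≡⟨ point-•ˡ u a _ u' ⟩
    point u (a • point v (point w (b • d) w') v') u'
      ≡⟨ cong (λ e → point u e u') (point-•ʳ v _ a v') ⟩
    point u (point v (a • point w (b • d) w') v') u'
      ≡⟨ cong (λ e → point u (point v e v') u') (point-•ʳ w _ a w') ⟩
    point³ u v w (a • (b • d)) u' v' w' ∎
    where open ≡-Reasoning

  point-assocʳ : (u v w : X) (a b d : Carrier) (u' v' w' : X) →
                 (point u a u' • point v b v') • point w d w'
                   ≡ point³ u v w ((a • b) • d) u' v' w'
  point-assocʳ u v w a b d u' v' w' = begin
    (point u a u' • point v b v') • point w d w'
      ≡⟨ cong (_• point w d w') (point-•ˡ u a _ u') ⟩
    point u (a • point v b v') u' • point w d w'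
      ≡⟨ cong (λ e → point u e u' • point w d w') (point-•ʳ v b a v') ⟩
    point u (point v (a • b) v') u' • point w d w'
      ≡⟨ point-•ˡ u _ _ u' ⟩
    point u (point v (a • b) v' • point w d w') u'
      ≡⟨ cong (λ e → point u e u') (point-•ˡ v _ _ v') ⟩
    point u (point v ((a • b) • point w d w') v') u'
      ≡⟨ cong (λ e → point u (point v e v') u') (point-•ʳ w d _ w') ⟩
    point³ u v w ((a • b) • d) u' v' w' ∎
    where open ≡-Reasoning

  points-∗-assocˡ-lower : (a b d : Carrier) {x u v w : X} → LeftSplit x u v w →
    a • (b • d) ≤ (point u a ∗ (point v b ∗ point w d)) x
  points-∗-assocˡ-lower a b d {u = u} {v} {w} (z , rxuz , rzvw) =
    trans (point³-upper u v w _)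
          (trans (reflexive (sym (point-assocˡ u v w a b d u v w)))
                 (∗-assocˡ-upper _ _ _ rxuz rzvw))

  points-∗-assocˡ-vanish : (a b d : Carrier) {x u v w : X} → ¬ LeftSplit x u v w →
    (point u a ∗ (point v b ∗ point w d)) x ≤ 𝟘
  points-∗-assocˡ-vanish a b d {x} {u} {v} {w} no-split =
    ∗-assocˡ-least _ _ _ x 𝟘 λ rxuz rzvw →
      trans (reflexive (point-assocˡ u v w a b d _ _ _))
            (point³-least λ { refl refl refl → ⊥-elim₀ (no-split (_ , rxuz , rzvw)) })

  points-∗-assocʳ-lower : (a b d : Carrier) {x u v w : X} → RightSplit x u v w →
    (a • b) • d ≤ ((point u a ∗ point v b) ∗ point w d) x
  points-∗-assocʳ-lower a b d {u = u} {v} {w} (y , ryuv , rxyw) =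
    trans (point³-upper u v w _)
          (trans (reflexive (sym (point-assocʳ u v w a b d u v w)))
                 (∗-assocʳ-upper _ _ _ ryuv rxyw))

  points-∗-assocʳ-vanish : (a b d : Carrier) {x u v w : X} → ¬ RightSplit x u v w →
    ((point u a ∗ point v b) ∗ point w d) x ≤ 𝟘
  points-∗-assocʳ-vanish a b d {x} {u} {v} {w} no-split =
    ∗-assocʳ-least _ _ _ x 𝟘 λ ryuv rxyw →
      trans (reflexive (point-assocʳ u v w a b d _ _ _))
            (point³-least λ { refl refl refl → ⊥-elim₀ (no-split (_ , ryuv , rxyw)) })

  -- If ∗ is associative and a • (b • d) ≠ 𝟘, every left splitting comes with
  -- a right splitting: otherwise a • (b • d) would lie below 𝟘.
  left⇒right : ExcludedMiddle ι → ConvAssociative R Q → (a b d : Carrier) →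
               ¬ (a • (b • d) ≡ 𝟘) → {x u v w : X} →
               LeftSplit x u v w → RightSplit x u v w
  left⇒right em ∗-assoc a b d nonzero {x} {u} {v} {w} split
    with em {RightSplit x u v w}
  ... | yes split′   = split′
  ... | no no-split′ = ⊥-elim₀ (nonzero (≤𝟘⇒≡𝟘 (begin
    a • (b • d)                               ≤⟨ points-∗-assocˡ-lower a b d split ⟩
    (point u a ∗ (point v b ∗ point w d)) x   ≡⟨ ∗-assoc _ _ _ x ⟩
    ((point u a ∗ point v b) ∗ point w d) x   ≤⟨ points-∗-assocʳ-vanish a b d no-split′ ⟩
    𝟘                                         ∎)))
    where open ≤-Reasoning

  right⇒left : ExcludedMiddle ι → ConvAssociative R Q → (a b d : Carrier) →
               ¬ ((a • b) • d ≡ 𝟘) → {x u v w : X} →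
               RightSplit x u v w → LeftSplit x u v w
  right⇒left em ∗-assoc a b d nonzero {x} {u} {v} {w} split
    with em {LeftSplit x u v w}
  ... | yes split′   = split′
  ... | no no-split′ = ⊥-elim₀ (nonzero (≤𝟘⇒≡𝟘 (begin
    (a • b) • d                               ≤⟨ points-∗-assocʳ-lower a b d split ⟩
    ((point u a ∗ point v b) ∗ point w d) x   ≡⟨ sym (∗-assoc _ _ _ x) ⟩
    (point u a ∗ (point v b ∗ point w d)) x   ≤⟨ points-∗-assocˡ-vanish a b d no-split′ ⟩
    𝟘                                         ∎)))
    where open ≤-Reasoning

  rel-assoc-from-∗ : ExcludedMiddle ι → ConvAssociative R Q →
                     (∃[ a ] ∃[ b ] ∃[ d ] (¬ (a • (b • d) ≡ 𝟘) × ¬ ((a • b) • d ≡ 𝟘))) →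
                     RelAssociative R
  rel-assoc-from-∗ em ∗-assoc (a , b , d , nonzeroˡ , nonzeroʳ) x u v w =
    mk⇔ (right⇒left em ∗-assoc a b d nonzeroʳ) (left⇒right em ∗-assoc a b d nonzeroˡ)

corollary4p6 : {c ℓ ι : Level} (X : Set ι) (R : X → X → X → Set ι) (Q : Prequantale c ℓ ι) →
    (RelAssociative R → •-Associative R Q → ConvAssociative R Q)
    × (ExcludedMiddle ι → ConvAssociative R Q →
         (∃[ a ] ∃[ b ] ∃[ c ]
           (¬ (Prequantale._•_ Q a (Prequantale._•_ Q b c) ≡ Prequantale.𝟘 Q)
            × ¬ (Prequantale._•_ Q (Prequantale._•_ Q a b) c ≡ Prequantale.𝟘 Q))) →
         RelAssociative R)
    × (ConvAssociative R Q →
         (∃[ x ] ∃[ y ] ∃[ z ] ∃[ u ] ∃[ v ] ∃[ w ]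
           (R x u z × R x y w × R z v w × R y u v)) →
         •-Associative R Q)
corollary4p6 X R Q = ∗-assoc-from-rel , rel-assoc-from-∗ , •-assoc-from-∗
  where open ConvolutionProperties R Q
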